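{- Let $q$ be a prime power, $n\ge1$, $0\le r\le n$, and $\alpha$ a primitive element of $\mathbb{F}_{q^n}$ (identified with $\mathbb{F}_q^n$). If $\gcd\!\left(\frac{q^r-1}{q-1},\frac{q^n-1}{q-1}\right)=1$, then every equivalence class of the relation $E_r$ contains exactly $\frac{q^n-1}{q-1}$ subspaces.
   Context: For a subspace $X$ of $\mathbb{F}_q^n$ and nonzero $\beta\in\mathbb{F}_{q^n}$, $\beta X=\{\beta x:x\in X\}$. $E_r$ is the equivalence relation on the set of $r$-dimensional subspaces of $\mathbb{F}_q^n$ given by $(X,Y)\in E_r$ iff $Y=\alpha^jX$ for some integer $j$. -}

module Defs where

open import Data.Nat as ℕ using (ℕ; zero; suc; _≤_; _^_)
open import Data.Nat.Primality using (Prime)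
open import Data.Integer as ℤ using (ℤ; +_; -[1+_])
open import Data.Fin as Fin using (Fin)
open import Data.Fin.Subset using (Subset; _∈_; ∣_∣)
open import Data.Fin.Subset.Properties using (_∈?_)
open import Data.Fin.Properties using (any?)
open import Data.Vec using (tabulate)
open import Data.Product using (Σ; ∃; _×_; _,_)
open import Function.Definitions using (Injective)
open import Relation.Nullary using (¬_; does)
open import Relation.Nullary.Decidable using (_×-dec_)
open import Relation.Binary.PropositionalEquality using (_≡_; _≢_)
import Algebra.Structures as S

IsPrimePower : ℕ → Set
IsPrimePower q = Σ ℕ λ p → Σ ℕ λ k → Prime p × (1 ≤ k) × (q ≡ p ^ k)

-- A field structure on a carrier A, with propositional equality.
-- (Every finite field of order N is isomorphic to one with carrier Fin N.)
record FieldOn (A : Set) : Set where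
  infixl 7 _*_
  infixl 6 _+_
  field
    _+_ _*_ : A → A → A
    -_ : A → A
    0# 1# : A
    _⁻¹ : A → A
    isCommutativeRing : S.IsCommutativeRing {A = A} _≡_ _+_ _*_ -_ 0# 1#
    0≢1 : 0# ≢ 1#
    ⁻¹-inverse : ∀ x → x ≢ 0# → x * (x ⁻¹) ≡ 1#

  pow : A → ℕ → A
  pow x zero = 1#
  pow x (suc k) = x * pow x k

  powℤ : A → ℤ → A
  powℤ x (+ k) = pow x k
  powℤ x -[1+ k ] = pow (x ⁻¹) (suc k)

  sumFin : (r : ℕ) → (Fin r → A) → A
  sumFin zero f = 0#
  sumFin (suc r) f = f Fin.zero + sumFin r (λ i → f (Fin.suc i))

FiniteField : ℕ → Set
FiniteField N = FieldOn (Fin N)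

module _ {N : ℕ} (K : FiniteField N) where
  open FieldOn K

  record IsSubfield (F : Subset N) : Set where
    field
      0∈ : 0# ∈ F
      1∈ : 1# ∈ F
      +-closed : ∀ {x y} → x ∈ F → y ∈ F → (x + y) ∈ F
      *-closed : ∀ {x y} → x ∈ F → y ∈ F → (x * y) ∈ F
      neg-closed : ∀ {x} → x ∈ F → (- x) ∈ F
      inv-closed : ∀ {x} → x ∈ F → x ≢ 0# → (x ⁻¹) ∈ F

  IsPrimitive : Fin N → Set
  IsPrimitive α = α ≢ 0# × (∀ x → x ≢ 0# → ∃ λ j → x ≡ pow α j)

  record IsSubspace (F : Subset N) (X : Subset N) : Set where
    field
      0∈ : 0# ∈ X
      +-closed : ∀ {x y} → x ∈ X → y ∈ X → (x + y) ∈ X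
      smul-closed : ∀ {c x} → c ∈ F → x ∈ X → (c * x) ∈ X

  IsFCoeffs : (F : Subset N) (r : ℕ) → (Fin r → Fin N) → Set
  IsFCoeffs F r c = ∀ i → c i ∈ F

  lincomb : (r : ℕ) → (Fin r → Fin N) → (Fin r → Fin N) → Fin N
  lincomb r c b = sumFin r (λ i → c i * b i)

  record IsBasis (F : Subset N) (r : ℕ) (b : Fin r → Fin N) (X : Subset N) : Set where
    field
      independent : ∀ c → IsFCoeffs F r c → lincomb r c b ≡ 0# → ∀ i → c i ≡ 0#
      spans : ∀ x → x ∈ X → ∃ λ c → IsFCoeffs F r c × x ≡ lincomb r c b
      inX : ∀ c → IsFCoeffs F r c → lincomb r c b ∈ X

  IsSubspaceOfDim : (F : Subset N) (r : ℕ) (X : Subset N) → Set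
  IsSubspaceOfDim F r X = IsSubspace F X × ∃ λ (b : Fin r → Fin N) → IsBasis F r b X

  -- βX = { β x : x ∈ X }
  scale : Fin N → Subset N → Subset N
  scale β X = tabulate λ y → does (any? λ x → (x ∈? X) ×-dec (β * x Fin.≟ y))

  E : (α : Fin N) → Subset N → Subset N → Set
  E α X Y = ∃ λ (j : ℤ) → Y ≡ scale (powℤ α j) X

  ClassHasSize : (F : Subset N) (r : ℕ) (α : Fin N) (X : Subset N) (M : ℕ) → Set
  ClassHasSize F r α X M =
    Σ (Fin M → Subset N) λ e →
      Injective _≡_ _≡_ e
      × (∀ k → IsSubspaceOfDim F r (e k) × E α X (e k))
      × (∀ Y → IsSubspaceOfDim F r Y → E α X Y → ∃ λ k → Y ≡ e k)

module Submission where

-- The E_r-class of X is {α^k X}, so its size is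
-- the least s > 0 with α^s X = X; we show s = M := m / (q - 1) under the gcd condition.
-- The recurring tool: a set of exponents closed under + and - consists of the
-- multiples of its least positive element (ExponentSet, IsPeriod), applied to the
-- returns of "shift sequences" j ↦ α^j, j ↦ γ^j x and j ↦ α^j X.  In order:
--  * α has order m, since its powers enumerate K ∖ {0} (Primitive);
--  * α^j ∈ F iff M | j, by counting F (Subfield); so α^M fixes X and M = u s;
--  * γ = α^s has order (q - 1) u and its orbits partition the q^r - 1 nonzero
--    vectors of X (SubspaceSize, OrbitCounting), so u | (q^r - 1) / (q - 1);
--  * u | M too, so u = 1 by the gcd condition (Class.stabilizer-period), and the
--    dilates α^k X, k < M, are the class, without repetition (Class.class-size).

open import Defs
open import Data.Nat using (ℕ; _≤_; _^_; _∸_; NonZero)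
open import Data.Nat.DivMod using (_/_)
open import Data.Nat.GCD using (gcd)
open import Data.Fin using (Fin)
open import Data.Fin.Subset using (Subset; ∣_∣)
open import Relation.Binary.PropositionalEquality using (_≡_)

open import Level using (0ℓ)
open import Algebra.Bundles using (CommutativeRing)
import Algebra.Properties.Group as GroupProperties
import Algebra.Properties.CommutativeSemigroup as CommutativeSemigroupProperties
open import Data.Nat
  using (zero; suc; pred; _+_; _*_; _<_; z≤n; s≤s; ≢-nonZero⁻¹; >-nonZero; >-nonZero⁻¹)
import Data.Nat.Properties as ℕ
open import Data.Nat.DivMod using (_%_; m≡m%n+[m/n]*n; m%n<n; m*n/n≡m)
open import Data.Nat.Divisibility using (_∣_; divides; _∣0; ∣-refl; ∣m∣n⇒∣m+n; ∣1⇒≡1; m*n∣o⇒n∣o/m)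
open import Data.Nat.GCD using (gcd-greatest)
open import Data.Integer using (+_; -[1+_])
open import Data.Bool using (Bool; true; false; _∧_; not; if_then_else_)
import Data.Bool as Bool
open import Data.Bool.Properties using (∧-conicalˡ; ∧-conicalʳ)
open import Data.Fin using (toℕ; finToFun; funToFin; combine)
import Data.Fin as Fin
import Data.Fin.Properties as Fin
open import Data.Fin.Subset using (_∈_; _⊆_)
open import Data.Fin.Subset.Properties using (_∈?_; ⊆-antisym)
open import Data.Fin.Properties using (any?)
open import Data.Vec using (lookup; _∷_; [])
import Data.Vec.Properties as Vec
open import Data.Product using (Σ; ∃; _×_; _,_; proj₁; proj₂)
open import Data.Sum using (_⊎_; inj₁; inj₂)
open import Data.Empty using (⊥-elim)
open import Function using (_∘_)
open import Function.Definitions using (Injective)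
open import Relation.Nullary using (¬_; Dec; yes; no; does)
open import Relation.Nullary.Decidable using (_×-dec_; dec-true; dec-false)
open import Relation.Unary using (Decidable)
open import Relation.Binary using (tri<; tri≈; tri>)
open import Relation.Binary.PropositionalEquality
  using (_≢_; refl; sym; trans; cong; cong₂; subst; subst₂; module ≡-Reasoning)

module Counting where

  count : ∀ {N} → (Fin N → Bool) → ℕ
  count {zero} b = 0
  count {suc N} b = (if b Fin.zero then 1 else 0) + count (b ∘ Fin.suc)

  HasSize : ∀ {N} → (Fin N → Bool) → ℕ → Set
  HasSize {N} b k =
    Σ (Fin k → Fin N) λ f →
      Injective _≡_ _≡_ f × (∀ i → b (f i) ≡ true) × (∀ x → b x ≡ true → ∃ λ i → f i ≡ x)

  enumerate : ∀ {N} (b : Fin N → Bool) → HasSize b (count b)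
  enumerate {zero} b = (λ ()) , (λ {}) , (λ ()) , (λ ())
  enumerate {suc N} b with b Fin.zero in b0 | enumerate (b ∘ Fin.suc)
  ... | true | f , inj , into , onto = g , g-inj , g-into , g-onto
    where
    g : Fin (suc (count (b ∘ Fin.suc))) → Fin (suc N)
    g Fin.zero = Fin.zero
    g (Fin.suc i) = Fin.suc (f i)
    g-inj : Injective _≡_ _≡_ g
    g-inj {Fin.zero} {Fin.zero} _ = refl
    g-inj {Fin.suc i} {Fin.suc j} e = cong Fin.suc (inj (Fin.suc-injective e))
    g-into : ∀ i → b (g i) ≡ true
    g-into Fin.zero = b0
    g-into (Fin.suc i) = into i
    g-onto : ∀ x → b x ≡ true → ∃ λ i → g i ≡ x
    g-onto Fin.zero _ = Fin.zero , refl
    g-onto (Fin.suc x) bx = let i , e = onto x bx in Fin.suc i , cong Fin.suc e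
  ... | false | f , inj , into , onto = Fin.suc ∘ f , inj ∘ Fin.suc-injective , into , g-onto
    where
    g-onto : ∀ x → b x ≡ true → ∃ λ i → Fin.suc (f i) ≡ x
    g-onto Fin.zero bx with () ← trans (sym b0) bx
    g-onto (Fin.suc x) bx = let i , e = onto x bx in i , cong Fin.suc e

  -- an enumeration of b injects into any enumeration of b
  HasSize-≤ : ∀ {N} {b : Fin N → Bool} {k k'} → HasSize b k → HasSize b k' → k ≤ k'
  HasSize-≤ {b = b} {k} {k'} (f , f-inj , f-into , _) (f' , _ , _ , f'-onto) =
    Fin.injective⇒≤ {f = index} index-inj
    where
    index : Fin k → Fin k'
    index i = proj₁ (f'-onto (f i) (f-into i))
    index-inj : Injective _≡_ _≡_ index
    index-inj {i} {j} e = f-inj (begin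
      f i                 ≡⟨ sym (proj₂ (f'-onto (f i) (f-into i))) ⟩
      f' (index i)        ≡⟨ cong f' e ⟩
      f' (index j)        ≡⟨ proj₂ (f'-onto (f j) (f-into j)) ⟩
      f j                 ∎)
      where open ≡-Reasoning

  HasSize⇒count : ∀ {N} {b : Fin N → Bool} {k} → HasSize b k → count b ≡ k
  HasSize⇒count {b = b} s = ℕ.≤-antisym (HasSize-≤ (enumerate b) s) (HasSize-≤ s (enumerate b))

  count-split : ∀ {N} (b c : Fin N → Bool) →
    count b ≡ count (λ x → b x ∧ c x) + count (λ x → b x ∧ not (c x))
  count-split {zero} b c = refl
  count-split {suc N} b c with b Fin.zero | c Fin.zero | count-split (b ∘ Fin.suc) (c ∘ Fin.suc)
  ... | true  | true  | ih = cong suc ih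
  ... | true  | false | ih = trans (cong suc ih) (sym (ℕ.+-suc _ _))
  ... | false | _     | ih = ih

  count≢0⇒witness : ∀ {N} (b : Fin N → Bool) → count b ≢ 0 → ∃ λ x → b x ≡ true
  count≢0⇒witness {zero} b ne = ⊥-elim (ne refl)
  count≢0⇒witness {suc N} b ne with b Fin.zero in b0
  ... | true = Fin.zero , b0
  ... | false = let x , bx = count≢0⇒witness (b ∘ Fin.suc) ne in Fin.suc x , bx

  count-lookup : ∀ {N} (S : Subset N) → count (lookup S) ≡ ∣ S ∣
  count-lookup [] = refl
  count-lookup (true ∷ S) = cong suc (count-lookup S)
  count-lookup (false ∷ S) = count-lookup S

open Counting

module LeastWitness {P : ℕ → Set} (P? : Decidable P) where

  search : ∀ n → (Σ ℕ λ d → P d × (∀ e → e < d → ¬ P e)) ⊎ (∀ e → e < n → ¬ P e)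
  search zero = inj₂ (λ _ ())
  search (suc n) with search n
  ... | inj₁ found = inj₁ found
  ... | inj₂ none with P? n
  ...   | yes Pn = inj₁ (n , Pn , none)
  ...   | no ¬Pn = inj₂ λ e e<1+n → case (ℕ.m<1+n⇒m<n∨m≡n e<1+n)
    where
    case : ∀ {e} → e < n ⊎ e ≡ n → ¬ P e
    case (inj₁ e<n) = none _ e<n
    case (inj₂ refl) = ¬Pn

  least : ∀ n → P n → Σ ℕ λ d → P d × (∀ e → e < d → ¬ P e)
  least n Pn with search (suc n)
  ... | inj₁ found = found
  ... | inj₂ none = ⊥-elim (none n ℕ.≤-refl Pn)


-- Exponent sets: sets of naturals containing 0 and closed under sums and
-- differences (the traces on ℕ of subgroups of ℤ).
record ExponentSet (P : ℕ → Set) : Set where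
  field
    zero∈ : P 0
    +-closed : ∀ {a b} → P a → P b → P (a + b)
    ∸-closed : ∀ {a b} → P (a + b) → P a → P b

record IsPeriod (P : ℕ → Set) (d : ℕ) : Set where
  field
    nonZero : NonZero d
    member : P d
    minimal : ∀ e → 0 < e → e < d → ¬ P e

period-exists : ∀ {P : ℕ → Set} → Decidable P → ∀ n → P (suc n) → ∃ (IsPeriod P)
period-exists {P} P? n Pn with LeastWitness.least {P = λ e → P (suc e)} (λ e → P? (suc e)) n Pn
... | d , Pd , below = suc d , record
  { nonZero = _
  ; member = Pd
  ; minimal = λ { (suc e) _ (s≤s e<d) → below e e<d }
  }

module PeriodFacts {P : ℕ → Set} (S : ExponentSet P) {d : ℕ} (per : IsPeriod P d) where
  open ExponentSet S
  open IsPeriod per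
  instance
    d≢0 : NonZero d
    d≢0 = nonZero

  multiples : ∀ k → P (k * d)
  multiples zero = zero∈
  multiples (suc k) = +-closed member (multiples k)

  -- the remainder of an element modulo d is again an element
  remainder∈ : ∀ {j} → P j → P (j % d)
  remainder∈ {j} Pj = ∸-closed {a = (j / d) * d} j∈ (multiples (j / d))
    where
    j∈ : P ((j / d) * d + j % d)
    j∈ = subst P (trans (m≡m%n+[m/n]*n j d) (ℕ.+-comm (j % d) _)) Pj

  -- ... and as it is below d, it must be 0
  period-divides : ∀ {j} → P j → d ∣ j
  period-divides {j} Pj with j % d in r≡ | remainder∈ Pj
  ... | zero  | _  = divides (j / d) (trans (m≡m%n+[m/n]*n j d) (cong (_+ (j / d) * d) r≡))
  ... | suc r | Pr = ⊥-elim (minimal (suc r) (s≤s z≤n) (subst (_< d) r≡ (m%n<n j d)) Pr)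

-- A sequence of points generated by injective shifts, point (a + b) = shift a (point b):
-- e.g. j ↦ xʲ in a field, or j ↦ αʲX for a set X.
record ShiftSequence (B : Set) : Set where
  field
    point : ℕ → B
    shift : ℕ → B → B
    shift-injective : ∀ a {x y} → shift a x ≡ shift a y → x ≡ y
    point-+ : ∀ a b → point (a + b) ≡ shift a (point b)

  Returns : ℕ → Set
  Returns j = point j ≡ point 0

  point≡shift : ∀ a → point a ≡ shift a (point 0)
  point≡shift a = trans (cong point (sym (ℕ.+-identityʳ a))) (point-+ a 0)

  returns-exponentSet : ExponentSet Returns
  returns-exponentSet = record
    { zero∈ = refl
    ; +-closed = λ {a} {b} ra rb → begin
        point (a + b)      ≡⟨ point-+ a b ⟩
        shift a (point b)  ≡⟨ cong (shift a) rb ⟩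
        shift a (point 0)  ≡⟨ sym (point≡shift a) ⟩
        point a            ≡⟨ ra ⟩
        point 0            ∎
    ; ∸-closed = λ {a} {b} rab ra → shift-injective a (begin
        shift a (point b)  ≡⟨ sym (point-+ a b) ⟩
        point (a + b)      ≡⟨ rab ⟩
        point 0            ≡⟨ sym ra ⟩
        point a            ≡⟨ point≡shift a ⟩
        shift a (point 0)  ∎)
    }
    where open ≡-Reasoning

  returns-difference : ∀ {k l} → k ≤ l → point k ≡ point l → Returns (l ∸ k)
  returns-difference {k} {l} k≤l e = shift-injective k (begin
    shift k (point (l ∸ k))  ≡⟨ sym (point-+ k (l ∸ k)) ⟩
    point (k + (l ∸ k))      ≡⟨ cong point (ℕ.m+[n∸m]≡n k≤l) ⟩
    point l                  ≡⟨ sym e ⟩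
    point k                  ≡⟨ point≡shift k ⟩
    shift k (point 0)        ∎)
    where open ≡-Reasoning

  module Cycle {d : ℕ} (per : IsPeriod Returns d) where
    open IsPeriod per
    open PeriodFacts returns-exponentSet per public

    periodic : ∀ j → point j ≡ point (j % d)
    periodic j = begin
      point j                                ≡⟨ cong point (m≡m%n+[m/n]*n j d) ⟩
      point (j % d + (j / d) * d)            ≡⟨ point-+ (j % d) _ ⟩
      shift (j % d) (point ((j / d) * d))    ≡⟨ cong (shift (j % d)) (multiples (j / d)) ⟩
      shift (j % d) (point 0)                ≡⟨ sym (point≡shift (j % d)) ⟩
      point (j % d)                          ∎
      where open ≡-Reasoning

    private
      distinct : ∀ {k l} → k < l → l < d → point k ≢ point l
      distinct {k} {l} k<l l<d e =
        minimal (l ∸ k) (ℕ.m<n⇒0<n∸m k<l) (ℕ.≤-<-trans (ℕ.m∸n≤m l k) l<d)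
          (returns-difference (ℕ.<⇒≤ k<l) e)

    injective-below : ∀ {k l} → k < d → l < d → point k ≡ point l → k ≡ l
    injective-below {k} {l} k<d l<d e with ℕ.<-cmp k l
    ... | tri< k<l _ _ = ⊥-elim (distinct k<l l<d e)
    ... | tri≈ _ k≡l _ = k≡l
    ... | tri> _ _ l<k = ⊥-elim (distinct l<k k<d (sym e))

module FieldFacts {A : Set} (K : FieldOn A) where
  open FieldOn K renaming (_+_ to _⊕_; _*_ to _·_)
  open ≡-Reasoning

  ring : CommutativeRing 0ℓ 0ℓ
  ring = record { isCommutativeRing = isCommutativeRing }

  open CommutativeRing ring public
    using (+-identityʳ; *-assoc; *-comm; *-identityˡ;
           distribˡ; distribʳ; zeroʳ; +-group; +-commutativeSemigroup)
  open CommutativeSemigroupProperties +-commutativeSemigroup public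
    using () renaming (interchange to +-interchange)
  open GroupProperties +-group public using (identityˡ-unique; x∙y⁻¹≈ε⇒x≈y; //-rightDividesˡ)

  *-cancelˡ : ∀ {x y z} → x ≢ 0# → x · y ≡ x · z → y ≡ z
  *-cancelˡ {x} {y} {z} x≢0 e = begin
    y                ≡⟨ sym (*-identityˡ y) ⟩
    1# · y           ≡⟨ cong (_· y) inverse-left ⟩
    (x ⁻¹ · x) · y   ≡⟨ *-assoc _ _ _ ⟩
    x ⁻¹ · (x · y)   ≡⟨ cong (x ⁻¹ ·_) e ⟩
    x ⁻¹ · (x · z)   ≡⟨ sym (*-assoc _ _ _) ⟩
    (x ⁻¹ · x) · z   ≡⟨ cong (_· z) (sym inverse-left) ⟩
    1# · z           ≡⟨ *-identityˡ z ⟩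
    z                ∎
    where
    inverse-left : 1# ≡ x ⁻¹ · x
    inverse-left = sym (trans (*-comm _ _) (⁻¹-inverse x x≢0))

  *-nonzero : ∀ {x y} → x ≢ 0# → y ≢ 0# → x · y ≢ 0#
  *-nonzero {x} x≢0 y≢0 xy≡0 = y≢0 (*-cancelˡ x≢0 (trans xy≡0 (sym (zeroʳ x))))

  pow-+ : ∀ x a b → pow x (a + b) ≡ pow x a · pow x b
  pow-+ x zero b = sym (*-identityˡ _)
  pow-+ x (suc a) b = trans (cong (x ·_) (pow-+ x a b)) (sym (*-assoc _ _ _))

  pow-* : ∀ x a b → pow x (a * b) ≡ pow (pow x a) b
  pow-* x a zero = cong (pow x) (ℕ.*-zeroʳ a)
  pow-* x a (suc b) = begin
    pow x (a * suc b)              ≡⟨ cong (pow x) (ℕ.*-suc a b) ⟩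
    pow x (a + a * b)              ≡⟨ pow-+ x a (a * b) ⟩
    pow x a · pow x (a * b)        ≡⟨ cong (pow x a ·_) (pow-* x a b) ⟩
    pow x a · pow (pow x a) b      ∎

  pow-nonzero : ∀ {x} k → x ≢ 0# → pow x k ≢ 0#
  pow-nonzero zero _ 1≡0 = 0≢1 (sym 1≡0)
  pow-nonzero (suc k) x≢0 = *-nonzero x≢0 (pow-nonzero k x≢0)

  sumFin-cong : ∀ r {f g : Fin r → A} → (∀ i → f i ≡ g i) → sumFin r f ≡ sumFin r g
  sumFin-cong zero e = refl
  sumFin-cong (suc r) e = cong₂ _⊕_ (e Fin.zero) (sumFin-cong r (λ i → e (Fin.suc i)))

  sumFin-+ : ∀ r (f g : Fin r → A) → sumFin r (λ i → f i ⊕ g i) ≡ sumFin r f ⊕ sumFin r g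
  sumFin-+ zero f g = sym (+-identityʳ 0#)
  sumFin-+ (suc r) f g =
    trans (cong (f Fin.zero ⊕ g Fin.zero ⊕_) (sumFin-+ r _ _)) (+-interchange _ _ _ _)

  sumFin-*ˡ : ∀ r β (f : Fin r → A) → sumFin r (λ i → β · f i) ≡ β · sumFin r f
  sumFin-*ˡ zero β f = sym (zeroʳ β)
  sumFin-*ˡ (suc r) β f =
    trans (cong (β · f Fin.zero ⊕_) (sumFin-*ˡ r β _)) (sym (distribˡ _ _ _))

  powers : (γ : A) → γ ≢ 0# → ShiftSequence A
  powers γ γ≢0 = record
    { point = pow γ
    ; shift = λ a y → pow γ a · y
    ; shift-injective = λ a → *-cancelˡ (pow-nonzero a γ≢0)
    ; point-+ = pow-+ γ
    }

  orbit : (γ : A) → γ ≢ 0# → A → ShiftSequence A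
  orbit γ γ≢0 x = record
    { point = λ j → pow γ j · x
    ; shift = λ a y → pow γ a · y
    ; shift-injective = λ a → *-cancelˡ (pow-nonzero a γ≢0)
    ; point-+ = λ a b → trans (cong (_· x) (pow-+ γ a b)) (*-assoc _ _ _)
    }

  HasOrder : A → ℕ → Set
  HasOrder γ g = IsPeriod (λ j → pow γ j ≡ 1#) g

  orbit-period : ∀ {γ g x} (γ≢0 : γ ≢ 0#) → x ≢ 0# → HasOrder γ g →
                 IsPeriod (ShiftSequence.Returns (orbit γ γ≢0 x)) g
  orbit-period {γ} {g} {x} _ x≢0 ord = record
    { nonZero = nonZero
    ; member = cong (_· x) member
    ; minimal = λ e 0<e e<g back → minimal e 0<e e<g (fixes⇒one {e} back)
    }
    where
    open IsPeriod ord
    fixes⇒one : ∀ {e} → pow γ e · x ≡ 1# · x → pow γ e ≡ 1#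
    fixes⇒one back = *-cancelˡ x≢0 (trans (*-comm x _) (trans back (*-comm 1# x)))

decided : ∀ {P : Set} (P? : Dec P) → does P? ≡ true → P
decided (yes p) _ = p

∈⇒lookup : ∀ {N} {x : Fin N} {S : Subset N} → x ∈ S → lookup S x ≡ true
∈⇒lookup = Vec.[]=⇒lookup

lookup⇒∈ : ∀ {N} {x : Fin N} {S : Subset N} → lookup S x ≡ true → x ∈ S
lookup⇒∈ {x = x} {S} = Vec.lookup⇒[]= x S

module Scaling {N : ℕ} (K : FiniteField N) where
  open FieldOn K renaming (_+_ to _⊕_; _*_ to _·_)
  open FieldFacts K
  open ≡-Reasoning

  -- the decision procedure by which scale decides y ∈ βX
  preimage? : ∀ β X y → Dec (∃ λ x → x ∈ X × β · x ≡ y)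
  preimage? β X y = any? λ x → (x ∈? X) ×-dec (β · x Fin.≟ y)

  ∈-scale⁻ : ∀ {β X y} → y ∈ scale K β X → ∃ λ x → x ∈ X × β · x ≡ y
  ∈-scale⁻ {β} {X} {y} y∈ =
    decided (preimage? β X y)
      (trans (sym (Vec.lookup∘tabulate (λ z → does (preimage? β X z)) y)) (∈⇒lookup y∈))

  ∈-scale : ∀ {β X x y} → x ∈ X → β · x ≡ y → y ∈ scale K β X
  ∈-scale {β} {X} {x} {y} x∈ βx≡y =
    lookup⇒∈ (trans (Vec.lookup∘tabulate (λ z → does (preimage? β X z)) y)
                    (dec-true (preimage? β X y) (x , x∈ , βx≡y)))

  scale-· : ∀ β γ X → scale K β (scale K γ X) ≡ scale K (β · γ) X
  scale-· β γ X = ⊆-antisym to from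
    where
    to : scale K β (scale K γ X) ⊆ scale K (β · γ) X
    to y∈ with ∈-scale⁻ y∈
    ... | z , z∈ , refl with ∈-scale⁻ z∈
    ... | x , x∈ , refl = ∈-scale x∈ (*-assoc β γ x)
    from : scale K (β · γ) X ⊆ scale K β (scale K γ X)
    from y∈ with ∈-scale⁻ y∈
    ... | x , x∈ , refl = ∈-scale (∈-scale x∈ refl) (sym (*-assoc β γ x))

  scale-1 : ∀ X → scale K 1# X ≡ X
  scale-1 X = ⊆-antisym to (λ x∈ → ∈-scale x∈ (*-identityˡ _))
    where
    to : scale K 1# X ⊆ X
    to y∈ with ∈-scale⁻ y∈
    ... | x , x∈ , refl = subst (_∈ X) (sym (*-identityˡ x)) x∈

  scaleOrbit : (α : Fin N) → α ≢ 0# → Subset N → ShiftSequence (Subset N)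
  scaleOrbit α α≢0 X = record
    { point = λ j → scale K (pow α j) X
    ; shift = λ a → scale K (pow α a)
    ; shift-injective = λ a → unscale (pow-nonzero a α≢0)
    ; point-+ = λ a b → trans (cong (λ β → scale K β X) (pow-+ α a b)) (sym (scale-· _ _ X))
    }
    where
    unscale : ∀ {β Y Z} → β ≢ 0# → scale K β Y ≡ scale K β Z → Y ≡ Z
    unscale {β} {Y} {Z} β≢0 e = begin
      Y                                ≡⟨ sym (scale-1 Y) ⟩
      scale K 1# Y                     ≡⟨ cong (λ γ → scale K γ Y) β⁻¹β≡1 ⟨
      scale K (β ⁻¹ · β) Y             ≡⟨ scale-· (β ⁻¹) β Y ⟨
      scale K (β ⁻¹) (scale K β Y)     ≡⟨ cong (scale K (β ⁻¹)) e ⟩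
      scale K (β ⁻¹) (scale K β Z)     ≡⟨ scale-· (β ⁻¹) β Z ⟩
      scale K (β ⁻¹ · β) Z             ≡⟨ cong (λ γ → scale K γ Z) β⁻¹β≡1 ⟩
      scale K 1# Z                     ≡⟨ scale-1 Z ⟩
      Z                                ∎
      where
      β⁻¹β≡1 : β ⁻¹ · β ≡ 1#
      β⁻¹β≡1 = trans (*-comm _ _) (⁻¹-inverse β β≢0)

  module _ {F : Subset N} where

    scale-fixes : ∀ {X c} → IsSubfield K F → IsSubspace K F X → c ∈ F → c ≢ 0# → scale K c X ≡ X
    scale-fixes {X} {c} sf sX c∈ c≢0 = ⊆-antisym to from
      where
      module SF = IsSubfield sf
      module SX = IsSubspace sX
      to : scale K c X ⊆ X
      to y∈ with ∈-scale⁻ y∈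
      ... | x , x∈ , refl = SX.smul-closed c∈ x∈
      from : X ⊆ scale K c X
      from {y} y∈ = ∈-scale (SX.smul-closed (SF.inv-closed c∈ c≢0) y∈) (begin
        c · (c ⁻¹ · y)  ≡⟨ *-assoc c (c ⁻¹) y ⟨
        (c · c ⁻¹) · y  ≡⟨ cong (_· y) (⁻¹-inverse c c≢0) ⟩
        1# · y          ≡⟨ *-identityˡ y ⟩
        y               ∎)

    scale-isSubspace : ∀ {β X} → IsSubspace K F X → IsSubspace K F (scale K β X)
    scale-isSubspace {β} {X} sX = record
      { 0∈ = ∈-scale SX.0∈ (zeroʳ β)
      ; +-closed = λ y∈ z∈ → sum (∈-scale⁻ y∈) (∈-scale⁻ z∈)
      ; smul-closed = λ c∈ y∈ → multiple c∈ (∈-scale⁻ y∈)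
      }
      where
      module SX = IsSubspace sX
      sum : ∀ {y z} → (∃ λ x → x ∈ X × β · x ≡ y) → (∃ λ x → x ∈ X × β · x ≡ z) →
            (y ⊕ z) ∈ scale K β X
      sum (x , x∈ , refl) (x' , x'∈ , refl) = ∈-scale (SX.+-closed x∈ x'∈) (distribˡ β x x')
      multiple : ∀ {c y} → c ∈ F → (∃ λ x → x ∈ X × β · x ≡ y) → (c · y) ∈ scale K β X
      multiple {c} c∈ (x , x∈ , refl) = ∈-scale (SX.smul-closed c∈ x∈) (begin
        β · (c · x)  ≡⟨ *-assoc β c x ⟨
        (β · c) · x  ≡⟨ cong (_· x) (*-comm β c) ⟩
        (c · β) · x  ≡⟨ *-assoc c β x ⟩
        c · (β · x)  ∎)

    lincomb-scale : ∀ r β (c b : Fin r → Fin N) →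
                    lincomb K r c (λ i → β · b i) ≡ β · lincomb K r c b
    lincomb-scale r β c b = trans (sumFin-cong r swap) (sumFin-*ˡ r β (λ i → c i · b i))
      where
      swap : ∀ i → c i · (β · b i) ≡ β · (c i · b i)
      swap i = begin
        c i · (β · b i)  ≡⟨ *-assoc (c i) β (b i) ⟨
        (c i · β) · b i  ≡⟨ cong (_· b i) (*-comm (c i) β) ⟩
        (β · c i) · b i  ≡⟨ *-assoc β (c i) (b i) ⟩
        β · (c i · b i)  ∎

    scale-isBasis : ∀ {r β b X} → β ≢ 0# → IsBasis K F r b X →
                    IsBasis K F r (λ i → β · b i) (scale K β X)
    scale-isBasis {r} {β} {b} {X} β≢0 bas = record
      { independent = λ c c∈ βΣ≡0 → B.independent c c∈
          (*-cancelˡ β≢0 (trans (sym (lincomb-scale r β c b)) (trans βΣ≡0 (sym (zeroʳ β)))))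
      ; spans = spans
      ; inX = λ c c∈ → ∈-scale (B.inX c c∈) (sym (lincomb-scale r β c b))
      }
      where
      module B = IsBasis bas
      spans : ∀ y → y ∈ scale K β X →
              ∃ λ c → IsFCoeffs K F r c × y ≡ lincomb K r c (λ i → β · b i)
      spans y y∈ with ∈-scale⁻ y∈
      ... | x , x∈ , refl with B.spans x x∈
      ... | c , c∈ , x≡ = c , c∈ , trans (cong (β ·_) x≡) (sym (lincomb-scale r β c b))

    scale-dim : ∀ {r β X} → β ≢ 0# → IsSubspaceOfDim K F r X → IsSubspaceOfDim K F r (scale K β X)
    scale-dim β≢0 (sX , b , bas) = scale-isSubspace sX , _ , scale-isBasis β≢0 bas

module Nonzero {N : ℕ} (K : FiniteField N) where
  open FieldOn K using (0#)

  zero? nonzero? : Fin N → Bool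
  zero? x = does (x Fin.≟ 0#)
  nonzero? x = not (zero? x)

  without-zero : ∀ b → b 0# ≡ true → count b ≡ suc (count (λ x → b x ∧ nonzero? x))
  without-zero b b0 = trans (count-split b zero?)
    (cong (_+ count (λ x → b x ∧ nonzero? x)) (HasSize⇒count only-zero))
    where
    only-zero : HasSize (λ x → b x ∧ zero? x) 1
    only-zero = (λ _ → 0#) , (λ { {Fin.zero} {Fin.zero} _ → refl })
      , (λ _ → cong₂ _∧_ b0 (dec-true (0# Fin.≟ 0#) refl))
      , λ x t → Fin.zero , sym (decided (x Fin.≟ 0#) (∧-conicalʳ (b x) _ t))

  nonzero?-true : ∀ {x} → x ≢ 0# → nonzero? x ≡ true
  nonzero?-true {x} x≢0 = cong not (dec-false (x Fin.≟ 0#) x≢0)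

  nonzero?⇒≢0 : ∀ {x} → nonzero? x ≡ true → x ≢ 0#
  nonzero?⇒≢0 {x} t x≡0 with () ← trans (sym (cong not (dec-true (x Fin.≟ 0#) x≡0))) t

-- In a field of N = m + 1 elements, a primitive element α has order exactly m:
-- the powers α⁰, …, α^(d-1) up to its order d enumerate the m nonzero elements.
module Primitive {N : ℕ} (K : FiniteField N) (m : ℕ) (N≡1+m : N ≡ suc m)
                 (α : Fin N) (prim : IsPrimitive K α) where
  open FieldOn K renaming (_+_ to _⊕_; _*_ to _·_)
  open FieldFacts K
  open Nonzero K
  open ≡-Reasoning

  α≢0 : α ≢ 0#
  α≢0 = proj₁ prim

  count-nonzero≡m : count nonzero? ≡ m
  count-nonzero≡m = ℕ.suc-injective (begin
    suc (count nonzero?)       ≡⟨ without-zero (λ _ → true) refl ⟨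
    count {N} (λ _ → true)     ≡⟨ HasSize⇒count everything ⟩
    N                          ≡⟨ N≡1+m ⟩
    suc m                      ∎)
    where
    everything : HasSize {N} (λ _ → true) N
    everything = (λ x → x) , (λ e → e) , (λ _ → refl) , (λ x _ → x , refl)

  module Powers = ShiftSequence (powers α α≢0)

  -- α⁻¹ is itself a power of α, so α has finite order
  α⁻¹-power : ∃ λ j → α ⁻¹ ≡ pow α j
  α⁻¹-power = proj₂ prim (α ⁻¹) α⁻¹≢0
    where
    α⁻¹≢0 : α ⁻¹ ≢ 0#
    α⁻¹≢0 α⁻¹≡0 = 0≢1 (trans (sym (zeroʳ α)) (trans (cong (α ·_) (sym α⁻¹≡0)) (⁻¹-inverse α α≢0)))

  α-returns : ∃ λ j → pow α (suc j) ≡ 1#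
  α-returns = let j , α⁻¹≡αʲ = α⁻¹-power in
    j , trans (cong (α ·_) (sym α⁻¹≡αʲ)) (⁻¹-inverse α α≢0)

  order≡m : ∀ {d} → HasOrder α d → d ≡ m
  order≡m {d} per = trans (sym (HasSize⇒count powers-below-d)) count-nonzero≡m
    where
    open Powers.Cycle per using (periodic; injective-below; d≢0)
    powers-below-d : HasSize nonzero? d
    powers-below-d = (λ i → pow α (toℕ i))
      , (λ e → Fin.toℕ-injective (injective-below (Fin.toℕ<n _) (Fin.toℕ<n _) e))
      , (λ i → nonzero?-true (pow-nonzero (toℕ i) α≢0))
      , λ x t → let j , x≡αʲ = proj₂ prim x (nonzero?⇒≢0 t) in
          Fin.fromℕ< (m%n<n j d) , (begin
            pow α (toℕ (Fin.fromℕ< (m%n<n j d)))  ≡⟨ cong (pow α) (Fin.toℕ-fromℕ< (m%n<n j d)) ⟩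
            pow α (j % d)                          ≡⟨ periodic j ⟨
            pow α j                                ≡⟨ x≡αʲ ⟨
            x                                      ∎)

  order : HasOrder α m
  order = let d , per = period-exists (λ j → pow α j Fin.≟ 1#) (proj₁ α-returns) (proj₂ α-returns) in
    subst (HasOrder α) (order≡m per) per

  powℤ-as-pow : ∀ z → ∃ λ j → powℤ α z ≡ pow α j
  powℤ-as-pow (+ k) = k , refl
  powℤ-as-pow -[1+ k ] = let j , α⁻¹≡αʲ = α⁻¹-power in
    j * suc k , trans (cong (λ β → pow β (suc k)) α⁻¹≡αʲ) (sym (pow-* α j (suc k)))

  power-order : ∀ s g {{s≢0 : NonZero s}} {{g≢0 : NonZero g}} → s * g ≡ m → HasOrder (pow α s) g
  power-order s g {{s≢0}} {{g≢0}} sg≡m = record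
    { nonZero = g≢0
    ; member = trans (sym (pow-* α s g)) (trans (cong (pow α) sg≡m) (IsPeriod.member order))
    ; minimal = λ e 0<e e<g αˢᵉ≡1 → ≢-nonZero⁻¹ (s * e) {{ℕ.m*n≢0 s e {{s≢0}} {{>-nonZero 0<e}}}}
        (injective-below (subst (s * e <_) sg≡m (ℕ.*-monoʳ-< s e<g)) (>-nonZero⁻¹ m)
                         (trans (pow-* α s e) αˢᵉ≡1))
    }
    where
    open Powers.Cycle order using (injective-below; d≢0)

-- A subfield F of size q = p + 2 consists of 0 and the powers of α^M, where
-- M = m / (q - 1): the exponents j with α^j ∈ F are the multiples of their least
-- positive element d, and counting F gives m = (q - 1) d.
module Subfield {N : ℕ} (K : FiniteField N) (m : ℕ) (N≡1+m : N ≡ suc m)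
                (α : Fin N) (prim : IsPrimitive K α)
                {F : Subset N} (sf : IsSubfield K F) where
  open FieldOn K renaming (_+_ to _⊕_; _*_ to _·_)
  open FieldFacts K
  open Primitive K m N≡1+m α prim
  open Powers.Cycle order using (periodic; injective-below; multiples; d≢0)
  module SF = IsSubfield sf
  open ≡-Reasoning

  InF : ℕ → Set
  InF j = pow α j ∈ F

  exponents : ExponentSet InF
  exponents = record
    { zero∈ = SF.1∈
    ; +-closed = λ {a} {b} a∈ b∈ → subst (_∈ F) (sym (pow-+ α a b)) (SF.*-closed a∈ b∈)
    ; ∸-closed = λ {a} {b} ab∈ a∈ →
        subst (_∈ F) (divide a b) (SF.*-closed (SF.inv-closed a∈ (pow-nonzero a α≢0)) ab∈)
    }
    where
    divide : ∀ a b → pow α a ⁻¹ · pow α (a + b) ≡ pow α b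
    divide a b = begin
      pow α a ⁻¹ · pow α (a + b)            ≡⟨ cong (pow α a ⁻¹ ·_) (pow-+ α a b) ⟩
      pow α a ⁻¹ · (pow α a · pow α b)      ≡⟨ *-assoc _ _ _ ⟨
      (pow α a ⁻¹ · pow α a) · pow α b      ≡⟨ cong (_· pow α b) (trans (*-comm _ _) (⁻¹-inverse _ (pow-nonzero a α≢0))) ⟩
      1# · pow α b                          ≡⟨ *-identityˡ _ ⟩
      pow α b                               ∎

  module _ {d : ℕ} (per : IsPeriod InF d) {k : ℕ} (m≡kd : m ≡ k * d) where
    open PeriodFacts exponents per using (period-divides) renaming (multiples to multiples∈F)

    enumeration : HasSize (lookup F) (suc k)
    enumeration = g , g-injective , (λ i → ∈⇒lookup (g∈F i)) , g-onto
      where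
      g : Fin (suc k) → Fin N
      g Fin.zero = 0#
      g (Fin.suc i) = pow α (toℕ i * d)
      g∈F : ∀ i → g i ∈ F
      g∈F Fin.zero = SF.0∈
      g∈F (Fin.suc i) = multiples∈F (toℕ i)
      below-m : ∀ {i} → i < k → i * d < m
      below-m {i} i<k = subst (i * d <_) (sym m≡kd) (ℕ.*-monoˡ-< d i<k)
        where instance _ = IsPeriod.nonZero per
      g-injective : Injective _≡_ _≡_ g
      g-injective {Fin.zero} {Fin.zero} _ = refl
      g-injective {Fin.zero} {Fin.suc j} e = ⊥-elim (pow-nonzero (toℕ j * d) α≢0 (sym e))
      g-injective {Fin.suc i} {Fin.zero} e = ⊥-elim (pow-nonzero (toℕ i * d) α≢0 e)
      g-injective {Fin.suc i} {Fin.suc j} e = cong Fin.suc (Fin.toℕ-injective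
        (ℕ.*-cancelʳ-≡ (toℕ i) (toℕ j) d {{IsPeriod.nonZero per}}
          (injective-below (below-m (Fin.toℕ<n i)) (below-m (Fin.toℕ<n j)) e)))
      g-onto : ∀ y → lookup F y ≡ true → ∃ λ i → g i ≡ y
      g-onto y y∈ with y Fin.≟ 0#
      ... | yes refl = Fin.zero , refl
      ... | no y≢0 with proj₂ prim y y≢0
      ... | j , refl with period-divides (subst (_∈ F) (periodic j) (lookup⇒∈ y∈))
      ... | divides c j%m≡cd = Fin.suc (Fin.fromℕ< c<k) , (begin
            pow α (toℕ (Fin.fromℕ< c<k) * d)  ≡⟨ cong (λ i → pow α (i * d)) (Fin.toℕ-fromℕ< c<k) ⟩
            pow α (c * d)                      ≡⟨ cong (pow α) j%m≡cd ⟨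
            pow α (j % m)                      ≡⟨ periodic j ⟨
            pow α j                            ∎)
        where
        c<k : c < k
        c<k = ℕ.*-cancelʳ-< d c k (subst₂ _<_ j%m≡cd m≡kd (m%n<n j m))

  subfield-exponent : ∀ p → ∣ F ∣ ≡ suc (suc p) → InF (m / suc p) × m ≡ suc p * (m / suc p)
  subfield-exponent p |F|≡q = subst InF (sym M≡d) (IsPeriod.member per) , m≡[p+1]M
    where
    αᵐ∈F : InF m
    αᵐ∈F = subst (_∈ F) (sym (IsPeriod.member order)) SF.1∈
    least-exponent : ∃ (IsPeriod InF)
    least-exponent = period-exists (λ j → pow α j ∈? F) (pred m) (subst InF (sym (ℕ.suc-pred m)) αᵐ∈F)
    d = proj₁ least-exponent
    per = proj₂ least-exponent
    d∣m : d ∣ m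
    d∣m = PeriodFacts.period-divides exponents per αᵐ∈F
    k = _∣_.quotient d∣m
    k≡p+1 : k ≡ suc p
    k≡p+1 = ℕ.suc-injective (begin
      suc k             ≡⟨ HasSize⇒count (enumeration per (_∣_.equality d∣m)) ⟨
      count (lookup F)  ≡⟨ count-lookup F ⟩
      ∣ F ∣             ≡⟨ |F|≡q ⟩
      suc (suc p)       ∎)
    m≡[p+1]d : m ≡ suc p * d
    m≡[p+1]d = trans (_∣_.equality d∣m) (cong (_* d) k≡p+1)
    M≡d : m / suc p ≡ d
    M≡d = trans (cong (_/ suc p) (trans m≡[p+1]d (ℕ.*-comm (suc p) d))) (m*n/n≡m d (suc p))
    m≡[p+1]M : m ≡ suc p * (m / suc p)
    m≡[p+1]M = trans m≡[p+1]d (cong (suc p *_) (sym M≡d))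

funToFin-cong : ∀ {a b} {f g : Fin a → Fin b} → (∀ k → f k ≡ g k) → funToFin f ≡ funToFin g
funToFin-cong {zero} e = refl
funToFin-cong {suc a} e = cong₂ combine (e Fin.zero) (funToFin-cong (λ k → e (Fin.suc k)))

-- An r-dimensional subspace over a subfield with q elements has q^r elements:
-- coordinates with respect to a basis are unique, so X ≅ F^r.
module SubspaceSize {N : ℕ} (K : FiniteField N) {F : Subset N} (sf : IsSubfield K F) where
  open FieldOn K renaming (_+_ to _⊕_; _*_ to _·_)
  open FieldFacts K
  module SF = IsSubfield sf
  open ≡-Reasoning

  coordinates-unique : ∀ {r b X} → IsBasis K F r b X → ∀ {c c'} → IsFCoeffs K F r c → IsFCoeffs K F r c' →
                       lincomb K r c b ≡ lincomb K r c' b → ∀ i → c i ≡ c' i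
  coordinates-unique {r} {b} bas {c} {c'} c∈ c'∈ e i =
    x∙y⁻¹≈ε⇒x≈y (c i) (c' i) (IsBasis.independent bas δ δ∈ (identityˡ-unique _ _ δ+c'≡c') i)
    where
    δ : Fin r → Fin N
    δ j = c j ⊕ - c' j
    δ∈ : IsFCoeffs K F r δ
    δ∈ j = SF.+-closed (c∈ j) (SF.neg-closed (c'∈ j))
    δ+c'≡c' : lincomb K r δ b ⊕ lincomb K r c' b ≡ lincomb K r c' b
    δ+c'≡c' = begin
      lincomb K r δ b ⊕ lincomb K r c' b         ≡⟨ sumFin-+ r _ _ ⟨
      sumFin r (λ j → δ j · b j ⊕ c' j · b j)    ≡⟨ sumFin-cong r (λ j → trans (sym (distribʳ (b j) (δ j) (c' j)))
                                                   (cong (_· b j) (//-rightDividesˡ (c' j) (c j)))) ⟩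
      lincomb K r c b                            ≡⟨ e ⟩
      lincomb K r c' b                           ∎

  subspace-size : ∀ {q r X} → HasSize (lookup F) q → IsSubspaceOfDim K F r X → HasSize (lookup X) (q ^ r)
  subspace-size {q} {r} {X} (φ , φ-injective , φ∈F , φ-onto) (_ , b , bas) =
    h , h-injective , (λ i → ∈⇒lookup (B.inX (coords i) (coords∈F i))) , h-onto
    where
    module B = IsBasis bas
    coords : Fin (q ^ r) → Fin r → Fin N
    coords i k = φ (finToFun i k)
    coords∈F : ∀ i → IsFCoeffs K F r (coords i)
    coords∈F i k = lookup⇒∈ (φ∈F (finToFun i k))
    h : Fin (q ^ r) → Fin N
    h i = lincomb K r (coords i) b
    h-injective : Injective _≡_ _≡_ h
    h-injective {i} {j} e = begin
      i                              ≡⟨ Fin.funToFin-finToFin {r} {q} i ⟨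
      funToFin {r} {q} (finToFun i)  ≡⟨ funToFin-cong (λ k → φ-injective
                                          (coordinates-unique bas (coords∈F i) (coords∈F j) e k)) ⟩
      funToFin {r} {q} (finToFun j)  ≡⟨ Fin.funToFin-finToFin {r} {q} j ⟩
      j                              ∎
    h-onto : ∀ x → lookup X x ≡ true → ∃ λ i → h i ≡ x
    h-onto x x∈ with B.spans x (lookup⇒∈ x∈)
    ... | c , c∈ , x≡ = funToFin index , trans (sumFin-cong r at) (sym x≡)
      where
      index : Fin r → Fin q
      index k = proj₁ (φ-onto (c k) (∈⇒lookup (c∈ k)))
      at : ∀ k → coords (funToFin index) k · b k ≡ c k · b k
      at k = cong (_· b k) (trans (cong φ (Fin.finToFun-funToFin index k))
                                  (proj₂ (φ-onto (c k) (∈⇒lookup (c∈ k)))))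

-- If γ has order g, every subset of K ∖ {0} closed under multiplication by γ
-- is a disjoint union of orbits {γ^i x : i < g} of size g, so g divides its size.
module OrbitCounting {N : ℕ} (K : FiniteField N) {γ : Fin N} (γ≢0 : γ ≢ FieldOn.0# K)
                     {g : ℕ} (ord : FieldFacts.HasOrder K γ g) where
  open FieldOn K renaming (_+_ to _⊕_; _*_ to _·_)
  open FieldFacts K
  open ≡-Reasoning
  instance
    g≢0 : NonZero g
    g≢0 = IsPeriod.nonZero ord

  Closed : (Fin N → Bool) → Set
  Closed b = ∀ x → b x ≡ true → b (γ · x) ≡ true

  Avoids0 : (Fin N → Bool) → Set
  Avoids0 b = ∀ x → b x ≡ true → x ≢ 0#

  closed-pow : ∀ {b x} → Closed b → b x ≡ true → ∀ i → b (pow γ i · x) ≡ true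
  closed-pow {b} {x} _ bx zero = subst (λ y → b y ≡ true) (sym (*-identityˡ x)) bx
  closed-pow {b} cl bx (suc i) = subst (λ y → b y ≡ true) (sym (*-assoc _ _ _)) (cl _ (closed-pow cl bx i))

  orbit? : ∀ x y → Dec (∃ λ (i : Fin g) → pow γ (toℕ i) · x ≡ y)
  orbit? x y = any? λ i → pow γ (toℕ i) · x Fin.≟ y

  inOrbit : Fin N → Fin N → Bool
  inOrbit x y = does (orbit? x y)

  undo-γ : ∀ y → pow γ (pred g) · (γ · y) ≡ y
  undo-γ y = begin
    pow γ (pred g) · (γ · y)   ≡⟨ *-assoc _ _ _ ⟨
    (pow γ (pred g) · γ) · y   ≡⟨ cong (_· y) (*-comm _ γ) ⟩
    pow γ (suc (pred g)) · y   ≡⟨ cong (λ k → pow γ k · y) (ℕ.suc-pred g) ⟩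
    pow γ g · y                ≡⟨ cong (_· y) (IsPeriod.member ord) ⟩
    1# · y                     ≡⟨ *-identityˡ y ⟩
    y                          ∎

  module _ {x : Fin N} (x≢0 : x ≢ 0#) where
    module Orbit = ShiftSequence (orbit γ γ≢0 x)
    open Orbit.Cycle (orbit-period γ≢0 x≢0 ord) using (periodic; injective-below)

    orbit-size : ∀ {b} → Closed b → b x ≡ true → HasSize (λ y → b y ∧ inOrbit x y) g
    orbit-size {b} cl bx = h
      , (λ e → Fin.toℕ-injective (injective-below (Fin.toℕ<n _) (Fin.toℕ<n _) e))
      , (λ i → cong₂ _∧_ (closed-pow cl bx (toℕ i)) (dec-true (orbit? x (h i)) (i , refl)))
      , λ y t → decided (orbit? x y) (∧-conicalʳ (b y) _ t)
      where
      h : Fin g → Fin N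
      h i = pow γ (toℕ i) · x

    -- an orbit is closed under γ⁻¹, so removing it from a closed set leaves a closed set
    orbit-closed⁻¹ : ∀ y → inOrbit x (γ · y) ≡ true → inOrbit x y ≡ true
    orbit-closed⁻¹ y t with decided (orbit? x (γ · y)) t
    ... | i , γⁱx≡γy = dec-true (orbit? x y) (Fin.fromℕ< (m%n<n k g) , (begin
      pow γ (toℕ (Fin.fromℕ< (m%n<n k g))) · x  ≡⟨ cong (λ j → pow γ j · x) (Fin.toℕ-fromℕ< (m%n<n k g)) ⟩
      pow γ (k % g) · x                          ≡⟨ periodic k ⟨
      pow γ (pred g + toℕ i) · x                 ≡⟨ Orbit.point-+ (pred g) (toℕ i) ⟩
      pow γ (pred g) · (pow γ (toℕ i) · x)       ≡⟨ cong (pow γ (pred g) ·_) γⁱx≡γy ⟩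
      pow γ (pred g) · (γ · y)                   ≡⟨ undo-γ y ⟩
      y                                          ∎))
      where
      k = pred g + toℕ i

    remove-orbit : ∀ {b} → Closed b → Closed (λ y → b y ∧ not (inOrbit x y))
    remove-orbit {b} cl y t = cong₂ _∧_ (cl y (∧-conicalˡ (b y) _ t)) (stays-out (∧-conicalʳ (b y) _ t))
      where
      stays-out : not (inOrbit x y) ≡ true → not (inOrbit x (γ · y)) ≡ true
      stays-out out with inOrbit x (γ · y) in e
      ... | false = refl
      ... | true with () ← trans (sym (cong not (orbit-closed⁻¹ y e))) out

  -- induction on (an upper bound for) the size, removing one orbit at a time
  orbits-divide : ∀ fuel b → count b ≤ fuel → Closed b → Avoids0 b → g ∣ count b
  orbits-divide zero b bound _ _ = subst (g ∣_) (sym (ℕ.n≤0⇒n≡0 bound)) (g ∣0)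
  orbits-divide (suc fuel) b bound cl avoids with count b ℕ.≟ 0
  ... | yes empty = subst (g ∣_) (sym empty) (g ∣0)
  ... | no nonempty = subst (g ∣_) (sym split) (∣m∣n⇒∣m+n ∣-refl
        (orbits-divide fuel rest rest-bound (remove-orbit x≢0 cl) (λ y t → avoids y (∧-conicalˡ (b y) _ t))))
    where
    x = proj₁ (count≢0⇒witness b nonempty)
    bx = proj₂ (count≢0⇒witness b nonempty)
    x≢0 = avoids x bx
    rest : Fin N → Bool
    rest y = b y ∧ not (inOrbit x y)
    split : count b ≡ g + count rest
    split = trans (count-split b (inOrbit x)) (cong (_+ count rest) (HasSize⇒count (orbit-size x≢0 cl bx)))
    rest-bound : count rest ≤ fuel
    rest-bound = ℕ.≤-pred (ℕ.≤-trans (ℕ.+-monoˡ-≤ (count rest) (>-nonZero⁻¹ g))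
                                     (subst (_≤ suc fuel) split bound))

module Class {N : ℕ} (K : FiniteField N) (m : ℕ) (N≡1+m : N ≡ suc m)
             (α : Fin N) (prim : IsPrimitive K α)
             {F : Subset N} (sf : IsSubfield K F) {r : ℕ} {X : Subset N} (X-dim : IsSubspaceOfDim K F r X) where
  open FieldOn K renaming (_+_ to _⊕_; _*_ to _·_)
  open FieldFacts K
  open Scaling K
  open Primitive K m N≡1+m α prim
  open ≡-Reasoning

  module Dilates = ShiftSequence (scaleOrbit α α≢0 X)
  open Dilates using (Returns)

  stable⇒returns : ∀ {j} → scale K (pow α j) X ≡ X → Returns j
  stable⇒returns αʲX≡X = trans αʲX≡X (sym (scale-1 X))

  returns⇒stable : ∀ {j} → Returns j → scale K (pow α j) X ≡ X
  returns⇒stable ret = trans ret (scale-1 X)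

  class-size : ∀ {d} → IsPeriod Returns d → ClassHasSize K F r α X d
  class-size {d} per = dilate
    , (λ e → Fin.toℕ-injective (injective-below (Fin.toℕ<n _) (Fin.toℕ<n _) e))
    , (λ k → scale-dim (pow-nonzero (toℕ k) α≢0) X-dim , + toℕ k , refl)
    , λ Y _ (z , Y≡) → let j , αᶻ≡αʲ = powℤ-as-pow z in
        Fin.fromℕ< (m%n<n j d) , (begin
          Y                                  ≡⟨ Y≡ ⟩
          scale K (powℤ α z) X               ≡⟨ cong (λ β → scale K β X) αᶻ≡αʲ ⟩
          scale K (pow α j) X                ≡⟨ periodic j ⟩
          scale K (pow α (j % d)) X          ≡⟨ cong (λ i → scale K (pow α i) X) (Fin.toℕ-fromℕ< (m%n<n j d)) ⟨
          dilate (Fin.fromℕ< (m%n<n j d))    ∎)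
    where
    open Dilates.Cycle per using (periodic; injective-below; d≢0)
    dilate : Fin d → Subset N
    dilate k = scale K (pow α (toℕ k)) X

  module _ (p : ℕ) (|F|≡q : ∣ F ∣ ≡ suc (suc p)) where
    open Nonzero K using (nonzero?; nonzero?-true; nonzero?⇒≢0; without-zero)
    open Subfield K m N≡1+m α prim sf using (subfield-exponent)
    open Powers.Cycle order using (d≢0)

    M : ℕ
    M = m / suc p

    m≡[p+1]M : m ≡ suc p * M
    m≡[p+1]M = proj₂ (subfield-exponent p |F|≡q)

    instance
      M≢0 : NonZero M
      M≢0 = ℕ.m*n≢0⇒n≢0 (suc p) {{subst NonZero m≡[p+1]M d≢0}}

    -- α^M lies in F, so it fixes the F-subspace X
    M-returns : Returns M
    M-returns = stable⇒returns {M}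
      (scale-fixes sf (proj₁ X-dim) (proj₁ (subfield-exponent p |F|≡q)) (pow-nonzero M α≢0))

    nonzero-vectors : count (λ y → lookup X y ∧ nonzero? y) ≡ suc (suc p) ^ r ∸ 1
    nonzero-vectors = cong (_∸ 1) (begin
      suc (count (λ y → lookup X y ∧ nonzero? y))  ≡⟨ without-zero (lookup X) (∈⇒lookup (IsSubspace.0∈ (proj₁ X-dim))) ⟨
      count (lookup X)                             ≡⟨ HasSize⇒count (SubspaceSize.subspace-size K sf F-size X-dim) ⟩
      suc (suc p) ^ r                              ∎)
      where
      F-size : HasSize (lookup F) (suc (suc p))
      F-size = subst (HasSize (lookup F)) (trans (count-lookup F) |F|≡q) (enumerate (lookup F))

    -- If s is the least positive return and M = u s, then γ = α^s has order
    -- (q - 1) u and permutes the nonzero vectors of X, so (q - 1) u | q^r - 1.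
    orbits-of-stabilizer : ∀ {s u} → IsPeriod Returns s → M ≡ u * s → suc p * u ∣ suc (suc p) ^ r ∸ 1
    orbits-of-stabilizer {s} {u} per M≡us =
      subst (suc p * u ∣_) nonzero-vectors
        (orbits-divide _ (λ y → lookup X y ∧ nonzero? y) ℕ.≤-refl closed avoids0)
      where
      instance
        s≢0 : NonZero s
        s≢0 = IsPeriod.nonZero per
        u≢0 : NonZero u
        u≢0 = ℕ.m*n≢0⇒m≢0 u {{subst NonZero M≡us M≢0}}
        g≢0 : NonZero (suc p * u)
        g≢0 = ℕ.m*n≢0 (suc p) u
      s[p+1]u≡m : s * (suc p * u) ≡ m
      s[p+1]u≡m = begin
        s * (suc p * u)    ≡⟨ ℕ.*-comm s _ ⟩
        (suc p * u) * s    ≡⟨ ℕ.*-assoc (suc p) u s ⟩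
        suc p * (u * s)    ≡⟨ cong (suc p *_) M≡us ⟨
        suc p * M          ≡⟨ m≡[p+1]M ⟨
        m                  ∎
      open OrbitCounting K (pow-nonzero s α≢0) (power-order s (suc p * u) s[p+1]u≡m)
      αˢX≡X : scale K (pow α s) X ≡ X
      αˢX≡X = returns⇒stable {s} (IsPeriod.member per)
      closed : Closed (λ y → lookup X y ∧ nonzero? y)
      closed y t = cong₂ _∧_
        (∈⇒lookup (subst (pow α s · y ∈_) αˢX≡X (∈-scale (lookup⇒∈ (∧-conicalˡ (lookup X y) _ t)) refl)))
        (nonzero?-true (*-nonzero (pow-nonzero s α≢0) (nonzero?⇒≢0 (∧-conicalʳ (lookup X y) _ t))))
      avoids0 : Avoids0 (λ y → lookup X y ∧ nonzero? y)
      avoids0 y t = nonzero?⇒≢0 (∧-conicalʳ (lookup X y) _ t)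

    stabilizer-period : gcd ((suc (suc p) ^ r ∸ 1) / suc p) M ≡ 1 → IsPeriod Returns M
    stabilizer-period coprime = subst (IsPeriod Returns) (sym M≡s) per
      where
      stabilizer : ∃ (IsPeriod Returns)
      stabilizer = period-exists (λ j → Vec.≡-dec Bool._≟_ (scale K (pow α j) X) (scale K 1# X))
                                 (pred M) (subst Returns (sym (ℕ.suc-pred M)) M-returns)
      s = proj₁ stabilizer
      per = proj₂ stabilizer
      s∣M : s ∣ M
      s∣M = PeriodFacts.period-divides Dilates.returns-exponentSet per M-returns
      u = _∣_.quotient s∣M
      u≡1 : u ≡ 1
      u≡1 = ∣1⇒≡1 (subst (u ∣_) coprime (gcd-greatest
        (m*n∣o⇒n∣o/m (suc p) u (orbits-of-stabilizer per (_∣_.equality s∣M)))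
        (divides s (trans (_∣_.equality s∣M) (ℕ.*-comm u s)))))
      M≡s : M ≡ s
      M≡s = trans (_∣_.equality s∣M) (trans (cong (_* s) u≡1) (ℕ.*-identityˡ s))

lemma2 : (q n r : ℕ) → IsPrimePower q → 1 ≤ n → r ≤ n →
    .{{_ : NonZero (q ∸ 1)}} →
    (K : FiniteField (q ^ n)) →
    (F : Subset (q ^ n)) → IsSubfield K F → ∣ F ∣ ≡ q →
    (α : Fin (q ^ n)) → IsPrimitive K α →
    gcd ((q ^ r ∸ 1) / (q ∸ 1)) ((q ^ n ∸ 1) / (q ∸ 1)) ≡ 1 →
    (X : Subset (q ^ n)) → IsSubspaceOfDim K F r X →
    ClassHasSize K F r α X ((q ^ n ∸ 1) / (q ∸ 1))
-- q = 0 and q = 1 are ruled out by the instance NonZero (q ∸ 1).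
lemma2 (suc (suc p)) n r _ _ _ K F sf |F|≡q α prim coprime X X-dim =
  class-size (stabilizer-period p |F|≡q coprime)
  where
  q = suc (suc p)
  N≡1+m : q ^ n ≡ suc (q ^ n ∸ 1)
  N≡1+m = sym (ℕ.suc-pred (q ^ n) {{ℕ.m^n≢0 q n}})
  open Class K (q ^ n ∸ 1) N≡1+m α prim sf X-dim
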